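{- For every on-line coloring algorithm $A$ and every positive integer $k$, there is an adversary strategy presenting on-line a finite family of segments attached to a horizontal line $h$, no three of which pairwise intersect (so the intersection graph has clique number at most $2$), such that $A$ uses at least $k$ distinct colors on this family.
   Context: A segment attached to a horizontal line $h$ is a line segment lying in the closed upper halfplane bounded by $h$ and having one endpoint on $h$. In the on-line coloring problem the segments are presented one at a time (by an adaptive adversary); when a segment is presented the algorithm must immediately and irrevocably assign it a color, knowing only the segments presented so far, such that intersecting segments always receive distinct colors. -}

module Defs where

open import Data.Nat using (ℕ; _≥_)
open import Data.Rational using (ℚ; _+_; _*_; _-_; _≤_; 0ℚ; 1ℚ)
open import Data.List using (List; length; lookup; take)
open import Data.Fin using (Fin; toℕ; _<_)
open import Data.Product using (_×_; ∃; ∃-syntax; Σ)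
open import Relation.Binary.PropositionalEquality using (_≡_; _≢_)
open import Relation.Nullary using (¬_)

-- The horizontal line h is fixed as the x-axis {y = 0} (w.l.o.g. up to
-- translation).
-- A segment attached to h: one endpoint (base , 0) on h, the other endpoint
-- (tipX , tipY) in the closed upper halfplane (tipY ≥ 0).
record Seg : Set where
  constructor seg
  field
    base : ℚ
    tipX : ℚ
    tipY : ℚ
    tipY≥0 : 0ℚ ≤ tipY
open Seg public

Intersect : Seg → Seg → Set
Intersect σ τ =
  ∃[ s ] ∃[ t ] ((0ℚ ≤ s) × (s ≤ 1ℚ) × (0ℚ ≤ t) × (t ≤ 1ℚ)
    × (base σ + s * (tipX σ - base σ) ≡ base τ + t * (tipX τ - base τ))
    × (s * tipY σ ≡ t * tipY τ))

-- A (deterministic) on-line coloring algorithm: given the segments presented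
-- so far (in order of presentation) and the newly presented segment, it
-- returns the color of the new segment.
OnlineAlg : Set
OnlineAlg = List Seg → Seg → ℕ

colorOf : OnlineAlg → (ss : List Seg) → Fin (length ss) → ℕ
colorOf A ss i = A (take (toℕ i) ss) (lookup ss i)

ProperOn : OnlineAlg → List Seg → Set
ProperOn A ss = ∀ (i j : Fin (length ss)) → i ≢ j →
  Intersect (lookup ss i) (lookup ss j) → colorOf A ss i ≢ colorOf A ss j

IsOnlineColoring : OnlineAlg → Set
IsOnlineColoring A = ∀ (ss : List Seg) → ProperOn A ss

TriangleFree : List Seg → Set
TriangleFree ss = ∀ (i j l : Fin (length ss)) → i < j → j < l →
  ¬ (Intersect (lookup ss i) (lookup ss j)
     × Intersect (lookup ss j) (lookup ss l)
     × Intersect (lookup ss i) (lookup ss l))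

UsesAtLeast : OnlineAlg → List Seg → ℕ → Set
UsesAtLeast A ss k = Σ (Fin k → Fin (length ss)) λ f →
  ∀ (a b : Fin k) → colorOf A ss (f a) ≡ colorOf A ss (f b) → a ≡ b

-- The adversary follows the classical on-line forcing of forests.  At level n it
-- forces n + 1 distinct colours on roots inside a strip ending at F.  For level
-- n + 1 it plays up to n + 2 rounds in fresh slots further to the left, each round
-- recursively forcing n + 1 root colours.  If some earlier cap has a colour not
-- among them, these roots and that cap carry n + 2 colours.  Otherwise a new cap of
-- level n + 1, from the left end of the round to F, crosses all the roots and so
-- gets a colour differing from all of them, hence from every earlier cap; after
-- n + 2 rounds the caps alone carry n + 2 colours.
-- Level-ℓ segments have slope N - ℓ, so a cap crosses exactly the steeper roots
-- reaching above it, and slots are spaced so that nothing else is within reach.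
-- Every segment meets at most one later segment, which excludes triangles.
module Submission where

open import Defs
open import Data.Nat using (ℕ; _≥_; zero; suc)
open import Data.Nat.Properties using (n<1+n)
open import Data.List using (List; [])
open import Data.Product using (_×_; ∃-syntax; _,_)
open import Data.Rational using (0ℚ)

module RationalOrder where

  open import Data.Rational
  open import Data.Rational.Properties
  open import Data.Rational.Solver
  open +-*-Solver
  open import Data.Sum using (inj₁; inj₂)
  open import Relation.Binary.PropositionalEquality

  ≤-gap : ∀ {p q} (c : ℚ) → 0ℚ ≤ c → q ≡ p + c → p ≤ q
  ≤-gap {p} c 0≤c refl = subst (_≤ p + c) (+-identityʳ p) (+-monoʳ-≤ p 0≤c)

  <-gap : ∀ {p q} (c : ℚ) → 0ℚ < c → q ≡ p + c → p < q
  <-gap {p} c 0<c refl = subst (_< p + c) (+-identityʳ p) (+-monoʳ-< p 0<c)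

  *-nonNeg : ∀ {p q} → 0ℚ ≤ p → 0ℚ ≤ q → 0ℚ ≤ p * q
  *-nonNeg {p} {q} 0≤p 0≤q =
    nonNegative⁻¹ _ {{nonNeg*nonNeg⇒nonNeg p {{nonNegative 0≤p}} q {{nonNegative 0≤q}}}}

  *-pos : ∀ {p q} → 0ℚ < p → 0ℚ < q → 0ℚ < p * q
  *-pos {p} {q} 0<p 0<q = positive⁻¹ _ {{pos*pos⇒pos p {{positive 0<p}} q {{positive 0<q}}}}

  +-nonNeg : ∀ {p q} → 0ℚ ≤ p → 0ℚ ≤ q → 0ℚ ≤ p + q
  +-nonNeg {p} {q} 0≤p 0≤q = subst (_≤ p + q) (+-identityʳ 0ℚ) (+-mono-≤ 0≤p 0≤q)

  +-pos : ∀ {p q} → 0ℚ < p → 0ℚ ≤ q → 0ℚ < p + q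
  +-pos {p} {q} 0<p 0≤q = subst (_< p + q) (+-identityʳ 0ℚ) (+-mono-<-≤ 0<p 0≤q)

  0<1 : 0ℚ < 1ℚ
  0<1 = positive⁻¹ 1ℚ

  0≤1 : 0ℚ ≤ 1ℚ
  0≤1 = <⇒≤ 0<1

  0≤p⇒0<p+1 : ∀ {p} → 0ℚ ≤ p → 0ℚ < p + 1ℚ
  0≤p⇒0<p+1 {p} 0≤p = subst (0ℚ <_) (+-comm 1ℚ p) (+-pos 0<1 0≤p)

  abstract
    p-1<p : ∀ p → p - 1ℚ < p
    p-1<p p = <-gap 1ℚ 0<1 (solve 1 (λ p → p := (p :- con 1ℚ) :+ con 1ℚ) refl p)

  0≤q-p⇒p≤q : ∀ {p q} → 0ℚ ≤ q - p → p ≤ q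
  0≤q-p⇒p≤q {p} {q} h = ≤-gap (q - p) h (solve 2 (λ p q → q := p :+ (q :- p)) refl p q)

  p≤q⇒0≤q-p : ∀ {p q} → p ≤ q → 0ℚ ≤ q - p
  p≤q⇒0≤q-p {p} {q} p≤q = subst (_≤ q - p) (+-inverseʳ p) (+-monoˡ-≤ (- p) p≤q)

  p<q⇒0<q-p : ∀ {p q} → p < q → 0ℚ < q - p
  p<q⇒0<q-p {p} {q} p<q = subst (_< q - p) (+-inverseʳ p) (+-monoˡ-< (- p) p<q)

  recip : (q : ℚ) → 0ℚ < q → ℚ
  recip q 0<q = (1/ q) {{pos⇒nonZero q {{positive 0<q}}}}

  recip-pos : ∀ q (0<q : 0ℚ < q) → 0ℚ < recip q 0<q
  recip-pos q 0<q = positive⁻¹ _ {{1/pos⇒pos q {{positive 0<q}}}}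

  *-recip-cancelʳ : ∀ p q (0<q : 0ℚ < q) → (p * recip q 0<q) * q ≡ p
  *-recip-cancelʳ p q 0<q = begin
    (p * recip q 0<q) * q ≡⟨ *-assoc p (recip q 0<q) q ⟩
    p * (recip q 0<q * q) ≡⟨ cong (p *_) (*-inverseˡ q {{pos⇒nonZero q {{positive 0<q}}}}) ⟩
    p * 1ℚ                ≡⟨ *-identityʳ p ⟩
    p                     ∎
    where open ≡-Reasoning

  *-recip-nonNeg : ∀ p q (0<q : 0ℚ < q) → 0ℚ ≤ p → 0ℚ ≤ p * recip q 0<q
  *-recip-nonNeg p q 0<q 0≤p = *-nonNeg 0≤p (<⇒≤ (recip-pos q 0<q))

  *-recip≤1 : ∀ p q (0<q : 0ℚ < q) → p ≤ q → p * recip q 0<q ≤ 1ℚ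
  *-recip≤1 p q 0<q p≤q =
    subst (p * r ≤_) (trans (*-comm q r) (*-inverseˡ q {{pos⇒nonZero q {{positive 0<q}}}}))
      (*-monoʳ-≤-nonNeg r {{nonNegative (<⇒≤ (recip-pos q 0<q))}} p≤q)
    where r = recip q 0<q

  convex-pos : ∀ {s p q} → 0ℚ ≤ s → s ≤ 1ℚ → 0ℚ < p → 0ℚ < q → 0ℚ < (1ℚ - s) * p + s * q
  convex-pos {s} {p} {q} 0≤s s≤1 0<p 0<q with ≤-total p q
  ... | inj₁ p≤q = <-≤-trans 0<p (≤-gap (s * (q - p)) (*-nonNeg 0≤s (p≤q⇒0≤q-p p≤q))
          (solve 3 (λ s p q → (con 1ℚ :- s) :* p :+ s :* q := p :+ s :* (q :- p)) refl s p q))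
  ... | inj₂ q≤p = <-≤-trans 0<q (≤-gap ((1ℚ - s) * (p - q)) (*-nonNeg (p≤q⇒0≤q-p s≤1) (p≤q⇒0≤q-p q≤p))
          (solve 3 (λ s p q → (con 1ℚ :- s) :* p :+ s :* q := q :+ (con 1ℚ :- s) :* (p :- q)) refl s p q))

module Separation where

  open RationalOrder
  open import Data.Rational
  open import Data.Rational.Properties
  open import Data.Rational.Solver
  open +-*-Solver
  open import Data.Product using (_,_)
  open import Relation.Binary.PropositionalEquality
  open import Relation.Nullary using (¬_)

  HasSlope : ℚ → Seg → Set
  HasSlope m σ = tipY σ ≡ m * (tipX σ - base σ)

  -- The affine map (x , y) ↦ m (x - base τ) - y vanishes along τ but is positive
  -- at both endpoints of σ, hence on all of σ.
  strictlyBelow⇒¬Intersect : ∀ σ τ m → HasSlope m τ →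
    0ℚ < m * (base σ - base τ) → tipY σ < m * (tipX σ - base τ) → ¬ Intersect σ τ
  strictlyBelow⇒¬Intersect σ τ m τ-slope base-below tip-below (s , t , 0≤s , s≤1 , _ , _ , eqX , eqY) =
    <-irrefl refl (subst (0ℚ <_) vanishes (convex-pos 0≤s s≤1 base-below (p<q⇒0<q-p tip-below)))
    where
    open ≡-Reasoning
    vanishes : (1ℚ - s) * (m * (base σ - base τ)) + s * (m * (tipX σ - base τ) - tipY σ) ≡ 0ℚ
    vanishes = begin
      (1ℚ - s) * (m * (base σ - base τ)) + s * (m * (tipX σ - base τ) - tipY σ)
        ≡⟨ solve 6 (λ m s bs xs bt ys → (con 1ℚ :- s) :* (m :* (bs :- bt)) :+ s :* (m :* (xs :- bt) :- ys)
                     := m :* ((bs :+ s :* (xs :- bs)) :- bt) :- s :* ys) refl m s (base σ) (tipX σ) (base τ) (tipY σ) ⟩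
      m * ((base σ + s * (tipX σ - base σ)) - base τ) - s * tipY σ
        ≡⟨ cong₂ (λ p q → m * (p - base τ) - q) eqX (trans eqY (cong (t *_) τ-slope)) ⟩
      m * ((base τ + t * (tipX τ - base τ)) - base τ) - t * (m * (tipX τ - base τ))
        ≡⟨ solve 4 (λ m t bt xt → m :* ((bt :+ t :* (xt :- bt)) :- bt) :- t :* (m :* (xt :- bt)) := con 0ℚ)
                   refl m t (base τ) (tipX τ) ⟩
      0ℚ ∎

  strictlyAbove⇒¬Intersect : ∀ σ τ m → HasSlope m σ →
    m * (base τ - base σ) < 0ℚ → m * (tipX τ - base σ) < tipY τ → ¬ Intersect σ τ
  strictlyAbove⇒¬Intersect σ τ m σ-slope base-above tip-above (s , t , _ , _ , 0≤t , t≤1 , eqX , eqY) =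
    <-irrefl refl (subst (0ℚ <_) vanishes (convex-pos 0≤t t≤1 (p<q⇒0<q-p base-above) (p<q⇒0<q-p tip-above)))
    where
    open ≡-Reasoning
    vanishes : (1ℚ - t) * (0ℚ - m * (base τ - base σ)) + t * (tipY τ - m * (tipX τ - base σ)) ≡ 0ℚ
    vanishes = begin
      (1ℚ - t) * (0ℚ - m * (base τ - base σ)) + t * (tipY τ - m * (tipX τ - base σ))
        ≡⟨ solve 6 (λ m t bs bt xt yt → (con 1ℚ :- t) :* (con 0ℚ :- m :* (bt :- bs)) :+ t :* (yt :- m :* (xt :- bs))
                     := t :* yt :- m :* ((bt :+ t :* (xt :- bt)) :- bs)) refl m t (base σ) (base τ) (tipX τ) (tipY τ) ⟩
      t * tipY τ - m * ((base τ + t * (tipX τ - base τ)) - base σ)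
        ≡⟨ cong₂ (λ q p → q - m * (p - base σ)) (trans (sym eqY) (cong (s *_) σ-slope)) (sym eqX) ⟩
      s * (m * (tipX σ - base σ)) - m * ((base σ + s * (tipX σ - base σ)) - base σ)
        ≡⟨ solve 4 (λ m s bs xs → s :* (m :* (xs :- bs)) :- m :* ((bs :+ s :* (xs :- bs)) :- bs) := con 0ℚ)
                   refl m s (base σ) (tipX σ) ⟩
      0ℚ ∎

  -- The crossing point is at parameter s = mc (bu - bc) / ((mu - mc)(xu - bu)) along u.
  shallower-crosses : ∀ u c mu mc → HasSlope mu u → HasSlope mc c → 0ℚ ≤ mc →
    base c ≤ base u → base u < tipX u → tipX u ≤ tipX c → mc < mu →
    mc * (tipX u - base c) ≤ tipY u → Intersect u c
  shallower-crosses u c mu mc u-slope c-slope 0≤mc bc≤bu bu<xu xu≤xc mc<mu u-reaches =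
    s , t , 0≤s , s≤1 , 0≤t , t≤1 , eqX , eqY
    where
    bu = base u
    xu = tipX u
    bc = base c
    xc = tipX c
    lift = mc * (bu - bc)
    rise = (mu - mc) * (xu - bu)
    0<rise : 0ℚ < rise
    0<rise = *-pos (p<q⇒0<q-p mc<mu) (p<q⇒0<q-p bu<xu)
    s = lift * recip rise 0<rise
    px = bu + s * (xu - bu)
    run = xc - bc
    0<run : 0ℚ < run
    0<run = p<q⇒0<q-p (≤-<-trans bc≤bu (<-≤-trans bu<xu xu≤xc))
    t = (px - bc) * recip run 0<run
    0≤s : 0ℚ ≤ s
    0≤s = *-recip-nonNeg lift rise 0<rise (*-nonNeg 0≤mc (p≤q⇒0≤q-p bc≤bu))
    s≤1 : s ≤ 1ℚ
    s≤1 = *-recip≤1 lift rise 0<rise (≤-gap (tipY u - mc * (xu - bc)) (p≤q⇒0≤q-p u-reaches)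
      (trans (solve 5 (λ mu mc bu xu bc → (mu :- mc) :* (xu :- bu)
                         := mc :* (bu :- bc) :+ (mu :* (xu :- bu) :- mc :* (xu :- bc))) refl mu mc bu xu bc)
             (cong (λ q → lift + (q - mc * (xu - bc))) (sym u-slope))))
    0≤t : 0ℚ ≤ t
    0≤t = *-recip-nonNeg (px - bc) run 0<run
      (subst (0ℚ ≤_) (solve 4 (λ bu bc s xu → (bu :- bc) :+ s :* (xu :- bu) := (bu :+ s :* (xu :- bu)) :- bc) refl bu bc s xu)
        (+-nonNeg (p≤q⇒0≤q-p bc≤bu) (*-nonNeg 0≤s (<⇒≤ (p<q⇒0<q-p bu<xu)))))
    t≤1 : t ≤ 1ℚ
    t≤1 = *-recip≤1 (px - bc) run 0<run (≤-gap ((xc - xu) + (1ℚ - s) * (xu - bu))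
      (+-nonNeg (p≤q⇒0≤q-p xu≤xc) (*-nonNeg (p≤q⇒0≤q-p s≤1) (<⇒≤ (p<q⇒0<q-p bu<xu))))
      (solve 5 (λ bu bc s xu xc → xc :- bc := ((bu :+ s :* (xu :- bu)) :- bc) :+ ((xc :- xu) :+ (con 1ℚ :- s) :* (xu :- bu)))
         refl bu bc s xu xc))
    t*run : t * run ≡ px - bc
    t*run = *-recip-cancelʳ (px - bc) run 0<run
    open ≡-Reasoning
    eqX : px ≡ bc + t * (xc - bc)
    eqX = begin
      px             ≡⟨ solve 2 (λ px bc → px := bc :+ (px :- bc)) refl px bc ⟩
      bc + (px - bc) ≡⟨ cong (bc +_) (sym t*run) ⟩
      bc + t * run   ∎
    eqY : s * tipY u ≡ t * tipY c
    eqY = begin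
      s * tipY u
        ≡⟨ cong (s *_) u-slope ⟩
      s * (mu * (xu - bu))
        ≡⟨ solve 5 (λ s mu mc xu bu → s :* (mu :* (xu :- bu)) := s :* ((mu :- mc) :* (xu :- bu)) :+ mc :* (s :* (xu :- bu)))
                   refl s mu mc xu bu ⟩
      s * rise + mc * (s * (xu - bu))
        ≡⟨ cong (_+ mc * (s * (xu - bu))) (*-recip-cancelʳ lift rise 0<rise) ⟩
      lift + mc * (s * (xu - bu))
        ≡⟨ solve 5 (λ mc bu bc s xu → mc :* (bu :- bc) :+ mc :* (s :* (xu :- bu)) := mc :* ((bu :+ s :* (xu :- bu)) :- bc))
                   refl mc bu bc s xu ⟩
      mc * (px - bc)
        ≡⟨ cong (mc *_) (sym t*run) ⟩
      mc * (t * run)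
        ≡⟨ solve 3 (λ mc t r → mc :* (t :* r) := t :* (mc :* r)) refl mc t run ⟩
      t * (mc * run)
        ≡⟨ cong (t *_) (sym c-slope) ⟩
      t * tipY c ∎

module Slopes (N : ℕ) where

  open import Data.Nat as ℕ using (ℕ; zero; suc; _∸_; z≤n; s≤s)

  open RationalOrder
  open Separation
  import Data.Nat.Properties as ℕ
  open import Data.Rational
  open import Data.Rational.Properties
  open import Data.Rational.Solver
  open +-*-Solver
  open import Relation.Binary.PropositionalEquality
  open import Relation.Nullary using (¬_)

  fromℕ : ℕ → ℚ
  fromℕ zero    = 0ℚ
  fromℕ (suc n) = 1ℚ + fromℕ n

  fromℕ-nonNeg : ∀ n → 0ℚ ≤ fromℕ n
  fromℕ-nonNeg zero    = ≤-refl
  fromℕ-nonNeg (suc n) = +-nonNeg 0≤1 (fromℕ-nonNeg n)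

  fromℕ-mono : ∀ {m n} → m ℕ.≤ n → fromℕ m ≤ fromℕ n
  fromℕ-mono {zero}  {n}     _         = fromℕ-nonNeg n
  fromℕ-mono {suc m} {suc n} (s≤s m≤n) = +-monoʳ-≤ 1ℚ (fromℕ-mono m≤n)

  1≤fromℕ-suc : ∀ n → 1ℚ ≤ fromℕ (suc n)
  1≤fromℕ-suc n = ≤-gap (fromℕ n) (fromℕ-nonNeg n) refl

  fromℕ-pos : ∀ {n} → 0 ℕ.< n → 0ℚ < fromℕ n
  fromℕ-pos {suc n} _ = <-≤-trans 0<1 (1≤fromℕ-suc n)

  -- Level-ℓ segments rise with slope N ∸ ℓ: higher levels are shallower, and
  -- every level below N is at least as steep as the diagonal.
  slope : ℕ → ℚ
  slope ℓ = fromℕ (N ∸ ℓ)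

  slope-nonNeg : ∀ ℓ → 0ℚ ≤ slope ℓ
  slope-nonNeg ℓ = fromℕ-nonNeg (N ∸ ℓ)

  slope-antimono : ∀ {ℓ ℓ′} → ℓ ℕ.≤ ℓ′ → slope ℓ′ ≤ slope ℓ
  slope-antimono ℓ≤ℓ′ = fromℕ-mono (ℕ.∸-monoʳ-≤ N ℓ≤ℓ′)

  slope≤N : ∀ ℓ → slope ℓ ≤ fromℕ N
  slope≤N ℓ = fromℕ-mono (ℕ.m∸n≤m N ℓ)

  1≤slope : ∀ {ℓ} → ℓ ℕ.< N → 1ℚ ≤ slope ℓ
  1≤slope {ℓ} ℓ<N with N ∸ ℓ | ℕ.m<n⇒0<n∸m ℓ<N
  ... | suc k | _ = 1≤fromℕ-suc k

  slope-pos : ∀ {ℓ} → ℓ ℕ.< N → 0ℚ < slope ℓ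
  slope-pos ℓ<N = <-≤-trans 0<1 (1≤slope ℓ<N)

  slope-suc : ∀ {ℓ} → ℓ ℕ.< N → slope ℓ ≡ 1ℚ + slope (suc ℓ)
  slope-suc {ℓ} ℓ<N = cong fromℕ (m∸n≡1+[m∸1+n] N ℓ ℓ<N)
    where
    m∸n≡1+[m∸1+n] : ∀ m n → n ℕ.< m → m ∸ n ≡ suc (m ∸ suc n)
    m∸n≡1+[m∸1+n] (suc m) zero    _         = refl
    m∸n≡1+[m∸1+n] (suc m) (suc n) (s≤s n<m) = m∸n≡1+[m∸1+n] m n n<m

  slope-strictAntimono : ∀ {ℓ ℓ′} → ℓ ℕ.< ℓ′ → ℓ′ ℕ.≤ N → slope ℓ′ < slope ℓ
  slope-strictAntimono {ℓ} {ℓ′} ℓ<ℓ′ ℓ′≤N = <-≤-trans (<-gap 1ℚ 0<1 (+-comm 1ℚ (slope ℓ′)))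
    (subst (1ℚ + slope ℓ′ ≤_) (sym (slope-suc (ℕ.<-≤-trans ℓ<ℓ′ ℓ′≤N))) (+-monoʳ-≤ 1ℚ (slope-antimono ℓ<ℓ′)))

  levelSeg : (ℓ : ℕ) (b x : ℚ) → b < x → Seg
  levelSeg ℓ b x b<x = seg b x (slope ℓ * (x - b)) (*-nonNeg (slope-nonNeg ℓ) (<⇒≤ (p<q⇒0<q-p b<x)))

  record OfLevel (ℓ : ℕ) (σ : Seg) : Set where
    field
      on-slope : HasSlope (slope ℓ) σ
      base<tip : base σ < tipX σ

  levelSeg-OfLevel : ∀ ℓ b x (b<x : b < x) → OfLevel ℓ (levelSeg ℓ b x b<x)
  levelSeg-OfLevel ℓ b x b<x = record { on-slope = refl ; base<tip = b<x }

  -- Out of reach of every segment based left of F that is at least as steep as the diagonal.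
  record Safe (F : ℚ) (σ : Seg) : Set where
    field
      F<base : F < base σ
      below-diagonal : tipY σ + F < tipX σ

  -- σ may still be hit from the left of F, but only by a shallower segment.
  record Pending (λ₀ : ℕ) (F : ℚ) (σ : Seg) : Set where
    field
      level : ℕ
      λ₀≤level : λ₀ ℕ.≤ level
      level<N : level ℕ.< N
      ofLevel : OfLevel level σ
      F<base : F < base σ

  record InStrip (lo hi : ℚ) (σ : Seg) : Set where
    field
      level : ℕ
      ofLevel : OfLevel level σ
      lo≤base : lo ≤ base σ
      tip≤hi : tipX σ ≤ hi

  Safe-mono : ∀ {F F′ σ} → F′ ≤ F → Safe F σ → Safe F′ σ
  Safe-mono {σ = σ} F′≤F record { F<base = F<base ; below-diagonal = below } = record
    { F<base = ≤-<-trans F′≤F F<base ; below-diagonal = ≤-<-trans (+-monoʳ-≤ (tipY σ) F′≤F) below }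

  Pending-mono : ∀ {λ₀ λ₁ F F′ σ} → λ₁ ℕ.≤ λ₀ → F′ ≤ F → Pending λ₀ F σ → Pending λ₁ F′ σ
  Pending-mono λ₁≤λ₀ F′≤F p = record
    { level = level ; λ₀≤level = ℕ.≤-trans λ₁≤λ₀ λ₀≤level ; level<N = level<N ; ofLevel = ofLevel
    ; F<base = ≤-<-trans F′≤F F<base }
    where open Pending p

  InStrip-mono : ∀ {lo hi lo′ hi′ σ} → lo′ ≤ lo → hi ≤ hi′ → InStrip lo hi σ → InStrip lo′ hi′ σ
  InStrip-mono lo′≤lo hi≤hi′ s = record
    { level = level ; ofLevel = ofLevel ; lo≤base = ≤-trans lo′≤lo lo≤base ; tip≤hi = ≤-trans tip≤hi hi≤hi′ }
    where open InStrip s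

  Safe⇒¬Intersect : ∀ {F σ ℓ b x} (b<x : b < x) → Safe F σ → b ≤ F → ℓ ℕ.< N →
    ¬ Intersect σ (levelSeg ℓ b x b<x)
  Safe⇒¬Intersect {F} {σ} {ℓ} {b} {x} b<x record { F<base = F<base ; below-diagonal = below } b≤F ℓ<N =
    strictlyBelow⇒¬Intersect σ (levelSeg ℓ b x b<x) (slope ℓ) refl
      (*-pos (slope-pos ℓ<N) (p<q⇒0<q-p (≤-<-trans b≤F F<base)))
      (<-gap ((tipX σ - (tipY σ + F)) + (F - b) + (slope ℓ - 1ℚ) * (tipX σ - b))
         (+-pos (+-pos (p<q⇒0<q-p below) (p≤q⇒0≤q-p b≤F)) (*-nonNeg (p≤q⇒0≤q-p (1≤slope ℓ<N)) 0≤tip-b))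
         (solve 5 (λ s X Y F b → s :* (X :- b) := Y :+ (((X :- (Y :+ F)) :+ (F :- b)) :+ (s :- con 1ℚ) :* (X :- b)))
            refl (slope ℓ) (tipX σ) (tipY σ) F b))
    where
    0≤tip-b : 0ℚ ≤ tipX σ - b
    0≤tip-b = p≤q⇒0≤q-p (≤-trans b≤F (≤-trans (≤-gap (tipY σ) (tipY≥0 σ) (+-comm (tipY σ) F)) (<⇒≤ below)))

  Pending⇒¬Intersect : ∀ {λ₀ F σ ℓ b x} (b<x : b < x) → Pending λ₀ F σ → ℓ ℕ.≤ λ₀ → b ≤ F →
    ¬ Intersect σ (levelSeg ℓ b x b<x)
  Pending⇒¬Intersect {λ₀} {F} {σ} {ℓ} {b} {x} b<x p ℓ≤λ₀ b≤F =
    strictlyAbove⇒¬Intersect σ (levelSeg ℓ b x b<x) (slope level) (OfLevel.on-slope ofLevel)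
      (<-gap (slope level * (base σ - b)) (*-pos (slope-pos level<N) (p<q⇒0<q-p b<base))
         (solve 3 (λ s b bs → con 0ℚ := s :* (b :- bs) :+ s :* (bs :- b)) refl (slope level) b (base σ)))
      (<-gap ((slope ℓ - slope level) * (x - b) + slope level * (base σ - b))
         (nonNeg+pos (*-nonNeg (p≤q⇒0≤q-p (slope-antimono (ℕ.≤-trans ℓ≤λ₀ λ₀≤level))) (<⇒≤ (p<q⇒0<q-p b<x)))
                     (*-pos (slope-pos level<N) (p<q⇒0<q-p b<base)))
         (solve 5 (λ sℓ s x b bs → sℓ :* (x :- b) := s :* (x :- bs) :+ ((sℓ :- s) :* (x :- b) :+ s :* (bs :- b)))
            refl (slope ℓ) (slope level) x b (base σ)))
    where
    open Pending p
    b<base : b < base σ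
    b<base = ≤-<-trans b≤F F<base
    nonNeg+pos : ∀ {p q} → 0ℚ ≤ p → 0ℚ < q → 0ℚ < p + q
    nonNeg+pos {p} {q} 0≤p 0<q = subst (0ℚ <_) (+-comm q p) (+-pos 0<q 0≤p)

  -- A segment in the strip [lo , hi] rises by at most N · (hi - lo).
  safeBound : ℚ → ℚ → ℚ
  safeBound lo hi = lo - (fromℕ N * (hi - lo) + 1ℚ)

  InStrip⇒Safe : ∀ {lo hi σ} → InStrip lo hi σ → Safe (safeBound lo hi) σ
  InStrip⇒Safe {lo} {hi} {σ} s = record { F<base = F<base ; below-diagonal = below }
    where
    open InStrip s
    b = base σ
    x = tipX σ
    0≤hi-lo : 0ℚ ≤ hi - lo
    0≤hi-lo = p≤q⇒0≤q-p (≤-trans lo≤base (≤-trans (<⇒≤ (OfLevel.base<tip ofLevel)) tip≤hi))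
    F<base : safeBound lo hi < b
    F<base = <-≤-trans (<-gap (fromℕ N * (hi - lo) + 1ℚ) (0≤p⇒0<p+1 (*-nonNeg (fromℕ-nonNeg N) 0≤hi-lo))
      (solve 3 (λ lo n d → lo := (lo :- (n :* d :+ con 1ℚ)) :+ (n :* d :+ con 1ℚ)) refl lo (fromℕ N) (hi - lo))) lo≤base
    below : tipY σ + safeBound lo hi < x
    below = subst (λ y → y + safeBound lo hi < x) (sym (OfLevel.on-slope ofLevel))
      (<-gap ((x - lo) + ((fromℕ N - slope level) * (hi - lo) + slope level * ((hi - x) + (b - lo))) + 1ℚ)
        (0≤p⇒0<p+1 (+-nonNeg (p≤q⇒0≤q-p (≤-trans lo≤base (<⇒≤ (OfLevel.base<tip ofLevel))))
          (+-nonNeg (*-nonNeg (p≤q⇒0≤q-p (slope≤N level)) 0≤hi-lo)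
                    (*-nonNeg (slope-nonNeg level) (+-nonNeg (p≤q⇒0≤q-p tip≤hi) (p≤q⇒0≤q-p lo≤base))))))
        (solve 6 (λ x b lo hi n s → x := (s :* (x :- b) :+ (lo :- (n :* (hi :- lo) :+ con 1ℚ))) :+
                     ((x :- lo) :+ ((n :- s) :* (hi :- lo) :+ s :* ((hi :- x) :+ (b :- lo))) :+ con 1ℚ))
           refl x b lo hi (fromℕ N) (slope level)))

module Presentations (A : OnlineAlg) where

  open import Data.Nat as ℕ using (ℕ; zero; suc; s≤s; _<_; _≤_)
  import Data.Nat.Properties as ℕ
  open import Data.Rational using (0ℚ)
  import Data.Rational.Properties as ℚ
  open import Data.List using (List; []; _∷_; _++_; [_]; length; take; lookup; _∷ʳ_)
  import Data.List.Properties as List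
  open import Data.Fin using (Fin; toℕ; fromℕ<)
  import Data.Vec.Functional as Vector
  import Data.Fin.Properties as Fin
  open import Data.Product using (Σ; _,_)
  open import Data.Sum using (_⊎_; inj₁; inj₂)
  open import Data.Empty using (⊥; ⊥-elim)
  open import Relation.Binary.PropositionalEquality
    using (_≡_; _≢_; refl; sym; trans; cong; cong₂; subst; subst₂)
  open import Relation.Nullary using (¬_)

  -- Out-of-range indices return a junk segment; every use below carries a bound.
  nth : List Seg → ℕ → Seg
  nth []       _       = seg 0ℚ 0ℚ 0ℚ ℚ.≤-refl
  nth (σ ∷ L) zero    = σ
  nth (σ ∷ L) (suc i) = nth L i

  nth-++ˡ : ∀ L M i → i < length L → nth (L ++ M) i ≡ nth L i
  nth-++ˡ (σ ∷ L) M zero    _         = refl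
  nth-++ˡ (σ ∷ L) M (suc i) (s≤s i<L) = nth-++ˡ L M i i<L

  nth-∷ʳ : ∀ L σ i → i < length L → nth (L ∷ʳ σ) i ≡ nth L i
  nth-∷ʳ L σ = nth-++ˡ L [ σ ]

  nth-∷ʳ-length : ∀ L σ → nth (L ∷ʳ σ) (length L) ≡ σ
  nth-∷ʳ-length []      σ = refl
  nth-∷ʳ-length (τ ∷ L) σ = nth-∷ʳ-length L σ

  length-∷ʳ : ∀ (L : List Seg) σ → length (L ∷ʳ σ) ≡ suc (length L)
  length-∷ʳ L σ = trans (List.length-++ L) (ℕ.+-comm (length L) 1)

  length<length-∷ʳ : ∀ (L : List Seg) σ → length L < length (L ∷ʳ σ)
  length<length-∷ʳ L σ = subst (length L <_) (sym (length-∷ʳ L σ)) (ℕ.n<1+n (length L))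

  take-++ : ∀ (L M : List Seg) p → p ≤ length L → take p (L ++ M) ≡ take p L
  take-++ L       M zero    _         = refl
  take-++ (σ ∷ L) M (suc p) (s≤s p≤L) = cong (σ ∷_) (take-++ L M p p≤L)

  ∷ʳ-index : ∀ (L : List Seg) σ i → i < length (L ∷ʳ σ) → i < length L ⊎ i ≡ length L
  ∷ʳ-index L σ i i< = ℕ.m≤n⇒m<n∨m≡n (ℕ.≤-pred (subst (suc i ≤_) (length-∷ʳ L σ) i<))

  ∷ʳ-new-index : ∀ (L : List Seg) σ {i} → length L ≤ i → i < length (L ∷ʳ σ) → i ≡ length L
  ∷ʳ-new-index L σ {i} L≤i i< with ∷ʳ-index L σ i i<
  ... | inj₁ i<L = ⊥-elim (ℕ.<⇒≱ i<L L≤i)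
  ... | inj₂ i≡L = i≡L

  infix 4 _≼_

  _≼_ : List Seg → List Seg → Set
  L ≼ L′ = Σ (List Seg) λ M → L′ ≡ L ++ M

  ≼-refl : ∀ L → L ≼ L
  ≼-refl L = [] , sym (List.++-identityʳ L)

  ≼-trans : ∀ {L₁ L₂ L₃} → L₁ ≼ L₂ → L₂ ≼ L₃ → L₁ ≼ L₃
  ≼-trans {L₁} (M , refl) (M′ , refl) = M ++ M′ , List.++-assoc L₁ M M′

  ≼-∷ʳ : ∀ L σ → L ≼ L ∷ʳ σ
  ≼-∷ʳ L σ = [ σ ] , refl

  ≼-length : ∀ {L L′} → L ≼ L′ → length L ≤ length L′
  ≼-length {L} (M , refl) = List.length-++-≤ˡ L

  ≼-nth : ∀ {L L′} → L ≼ L′ → ∀ i → i < length L → nth L′ i ≡ nth L i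
  ≼-nth {L} (M , refl) = nth-++ˡ L M

  colour : List Seg → ℕ → ℕ
  colour L p = A (take p L) (nth L p)

  -- The algorithm only sees the past, so colours never change.
  ≼-colour : ∀ {L L′} → L ≼ L′ → ∀ p → p < length L → colour L′ p ≡ colour L p
  ≼-colour {L} e@(M , refl) p p<L = cong₂ A (take-++ L M p (ℕ.<⇒≤ p<L)) (≼-nth e p p<L)

  record Entry (P : Seg → Set) (L : List Seg) : Set where
    field
      pos : ℕ
      pos< : pos < length L
      holds : P (nth L pos)

  Entry-map : ∀ {P Q : Seg → Set} {L} → (∀ {σ} → P σ → Q σ) → Entry P L → Entry Q L
  Entry-map P⇒Q e = record { pos = Entry.pos e ; pos< = Entry.pos< e ; holds = P⇒Q (Entry.holds e) }

  Entry-≼ : ∀ {P L L′} → L ≼ L′ → Entry P L → Entry P L′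
  Entry-≼ {P} L≼L′ e = record
    { pos = pos ; pos< = ℕ.<-≤-trans pos< (≼-length L≼L′) ; holds = subst P (sym (≼-nth L≼L′ pos pos<)) holds }
    where open Entry e

  Entry-∷ʳ : ∀ {P : Seg → Set} {σ} L → P σ → Entry P (L ∷ʳ σ)
  Entry-∷ʳ {P} {σ} L Pσ = record
    { pos = length L ; pos< = length<length-∷ʳ L σ ; holds = subst P (sym (nth-∷ʳ-length L σ)) Pσ }

  Rainbow : ∀ {P L k} → (Fin k → Entry P L) → Set
  Rainbow {L = L} es = ∀ a b → colour L (Entry.pos (es a)) ≡ colour L (Entry.pos (es b)) → a ≡ b

  Rainbow-≼ : ∀ {P L L′ k} (L≼L′ : L ≼ L′) {es : Fin k → Entry P L} → Rainbow es →
    Rainbow (λ a → Entry-≼ L≼L′ (es a))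
  Rainbow-≼ L≼L′ {es} rainbow a b same = rainbow a b
    (trans (sym (≼-colour L≼L′ _ (Entry.pos< (es a)))) (trans same (≼-colour L≼L′ _ (Entry.pos< (es b)))))

  Rainbow-∷ : ∀ {P L k} (e : Entry P L) {es : Fin k → Entry P L} →
    (∀ a → colour L (Entry.pos (es a)) ≢ colour L (Entry.pos e)) → Rainbow es → Rainbow (e Vector.∷ es)
  Rainbow-∷ e fresh rainbow Fin.zero    Fin.zero    _    = refl
  Rainbow-∷ e fresh rainbow Fin.zero    (Fin.suc b) same = ⊥-elim (fresh b (sym same))
  Rainbow-∷ e fresh rainbow (Fin.suc a) Fin.zero    same = ⊥-elim (fresh a same)
  Rainbow-∷ e fresh rainbow (Fin.suc a) (Fin.suc b) same = cong Fin.suc (rainbow a b same)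

  Meets : List Seg → ℕ → ℕ → Set
  Meets L i j = Intersect (nth L i) (nth L j)

  HitOnce : List Seg → Set
  HitOnce L = ∀ i j l → i < j → j < l → l < length L → Meets L i j → Meets L i l → ⊥

  HitAre : (Seg → Set) → List Seg → Set
  HitAre P L = ∀ i j → i < j → j < length L → Meets L i j → P (nth L i)

  HitAre-mono : ∀ {P Q : Seg → Set} {L} → (∀ {σ} → P σ → Q σ) → HitAre P L → HitAre Q L
  HitAre-mono P⇒Q hit i j i<j j<L meet = P⇒Q (hit i j i<j j<L meet)

  HitOnce-∷ʳ : ∀ {L σ} → HitOnce L → HitAre (λ τ → ¬ Intersect τ σ) L → HitOnce (L ∷ʳ σ)
  HitOnce-∷ʳ {L} {σ} once hitMiss i j l i<j j<l l< ij il with ∷ʳ-index L σ l l<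
  ... | inj₁ l<L = once i j l i<j j<l l<L (subst₂ Intersect (nth-∷ʳ L σ i i<L) (nth-∷ʳ L σ j j<L) ij)
                                            (subst₂ Intersect (nth-∷ʳ L σ i i<L) (nth-∷ʳ L σ l l<L) il)
    where
    j<L = ℕ.<-trans j<l l<L
    i<L = ℕ.<-trans i<j j<L
  ... | inj₂ refl = hitMiss i j i<j j<l (subst₂ Intersect (nth-∷ʳ L σ i i<L) (nth-∷ʳ L σ j j<l) ij)
                      (subst₂ Intersect (nth-∷ʳ L σ i i<L) (nth-∷ʳ-length L σ) il)
    where
    i<L = ℕ.<-trans i<j j<l

  HitAre-∷ʳ : ∀ {P L σ} → HitAre P L → (∀ i → i < length L → Intersect (nth L i) σ → P (nth L i)) →
    HitAre P (L ∷ʳ σ)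
  HitAre-∷ʳ {P} {L} {σ} hit hitNew i j i<j j< meet with ∷ʳ-index L σ j j<
  ... | inj₁ j<L = subst P (sym (nth-∷ʳ L σ i i<L)) (hit i j i<j j<L (subst₂ Intersect (nth-∷ʳ L σ i i<L) (nth-∷ʳ L σ j j<L) meet))
    where
    i<L = ℕ.<-trans i<j j<L
  ... | inj₂ refl = subst P (sym (nth-∷ʳ L σ i i<j)) (hitNew i i<j (subst₂ Intersect (nth-∷ʳ L σ i i<j) (nth-∷ʳ-length L σ) meet))

  lookup≡nth : ∀ L (i : Fin (length L)) → lookup L i ≡ nth L (toℕ i)
  lookup≡nth (σ ∷ L) Fin.zero    = refl
  lookup≡nth (σ ∷ L) (Fin.suc i) = lookup≡nth L i

  colourOf-fromℕ< : ∀ L p (p<L : p < length L) → colorOf A L (fromℕ< p<L) ≡ colour L p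
  colourOf-fromℕ< L p p<L = trans (cong (A (take (toℕ i) L)) (lookup≡nth L i)) (cong (colour L) (Fin.toℕ-fromℕ< p<L))
    where i = fromℕ< p<L

  HitOnce⇒TriangleFree : ∀ L → HitOnce L → TriangleFree L
  HitOnce⇒TriangleFree L once i j l i<j j<l (ij , _ , il) =
    once (toℕ i) (toℕ j) (toℕ l) i<j j<l (Fin.toℕ<n l)
      (subst₂ Intersect (lookup≡nth L i) (lookup≡nth L j) ij)
      (subst₂ Intersect (lookup≡nth L i) (lookup≡nth L l) il)

  colour-∷ʳ-≢ : IsOnlineColoring A → ∀ L σ p → p < length L → Intersect (nth L p) σ →
    colour (L ∷ʳ σ) p ≢ colour (L ∷ʳ σ) (length L)
  colour-∷ʳ-≢ proper L σ p p<L meet same =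
    proper (L ∷ʳ σ) i j i≢j meet′
      (trans (colourOf-fromℕ< (L ∷ʳ σ) p p<) (trans same (sym (colourOf-fromℕ< (L ∷ʳ σ) (length L) new<))))
    where
    p< : p < length (L ∷ʳ σ)
    p< = ℕ.<-trans p<L (length<length-∷ʳ L σ)
    new< = length<length-∷ʳ L σ
    i = fromℕ< p<
    j = fromℕ< new<
    i≢j : i ≢ j
    i≢j i≡j = ℕ.<⇒≢ p<L (trans (sym (Fin.toℕ-fromℕ< p<)) (trans (cong toℕ i≡j) (Fin.toℕ-fromℕ< new<)))
    meet′ : Intersect (lookup (L ∷ʳ σ) i) (lookup (L ∷ʳ σ) j)
    meet′ = subst₂ Intersect
      (sym (trans (lookup≡nth (L ∷ʳ σ) i) (trans (cong (nth (L ∷ʳ σ)) (Fin.toℕ-fromℕ< p<)) (nth-∷ʳ L σ p p<L))))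
      (sym (trans (lookup≡nth (L ∷ʳ σ) j) (trans (cong (nth (L ∷ʳ σ)) (Fin.toℕ-fromℕ< new<)) (nth-∷ʳ-length L σ))))
      meet

  Rainbow⇒UsesAtLeast : ∀ {P L k} (es : Fin k → Entry P L) → Rainbow es → UsesAtLeast A L k
  Rainbow⇒UsesAtLeast {L = L} es rainbow = (λ a → fromℕ< (Entry.pos< (es a))) , λ a b same →
    rainbow a b (trans (sym (colourOf-fromℕ< L _ (Entry.pos< (es a)))) (trans same (colourOf-fromℕ< L _ (Entry.pos< (es b)))))

module Construction (A : OnlineAlg) (proper : IsOnlineColoring A) (N : ℕ) where

  open import Data.Nat as ℕ using (ℕ; zero; suc; z≤n; s≤s; _≤_; _<_)

  open RationalOrder
  open Separation
  open Slopes N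
  open Presentations A
  import Data.Nat.Properties as ℕ
  open import Data.Rational as ℚ using (ℚ; 0ℚ; 1ℚ; _+_; _*_; _-_)
  open import Data.Rational.Properties as ℚ using (≤-refl; ≤-trans; <-≤-trans; ≤-<-trans; <⇒≤)
  open import Data.Rational.Solver
  open +-*-Solver
  open import Data.List using (List; []; length; _∷ʳ_)
  open import Data.Fin as Fin using (Fin)
  import Data.Fin.Properties as Fin
  import Data.Vec.Functional as Vector
  open import Data.Product using (Σ; ∃; _,_; proj₁; proj₂)
  open import Data.Sum using (_⊎_; inj₁; inj₂)
  open import Data.Empty using (⊥-elim)
  open import Relation.Binary.PropositionalEquality
    using (_≡_; _≢_; refl; sym; trans; cong; subst; subst₂)
  open import Relation.Nullary using (¬_; yes; no; ¬?; Dec)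

  -- A level-(n + 1) gadget consists of n + 2 slots of length gap n, each holding a
  -- level-n gadget followed by its clearance (see safeBound), and to their right a
  -- margin of N · slots n which lets every cap reach the roots of its slot.
  width : ℕ → ℚ
  gap : ℕ → ℚ
  slots : ℕ → ℚ
  width zero    = 1ℚ
  width (suc n) = fromℕ N * slots n + slots n
  gap n = (fromℕ N + 1ℚ) * width n + 1ℚ
  slots n = fromℕ (suc (suc n)) * gap n

  width-nonNeg : ∀ n → 0ℚ ℚ.≤ width n
  gap-pos : ∀ n → 0ℚ ℚ.< gap n
  slots-nonNeg : ∀ n → 0ℚ ℚ.≤ slots n
  width-nonNeg zero    = 0≤1
  width-nonNeg (suc n) = +-nonNeg (*-nonNeg (fromℕ-nonNeg N) (slots-nonNeg n)) (slots-nonNeg n)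
  gap-pos n = 0≤p⇒0<p+1 (*-nonNeg (+-nonNeg (fromℕ-nonNeg N) 0≤1) (width-nonNeg n))
  slots-nonNeg n = *-nonNeg (fromℕ-nonNeg (suc (suc n))) (<⇒≤ (gap-pos n))

  width<gap : ∀ n → width n ℚ.< gap n
  width<gap n = <-gap (fromℕ N * width n + 1ℚ) (0≤p⇒0<p+1 (*-nonNeg (fromℕ-nonNeg N) (width-nonNeg n)))
    (solve 2 (λ N w → (N :+ con 1ℚ) :* w :+ con 1ℚ := w :+ (N :* w :+ con 1ℚ)) refl (fromℕ N) (width n))

  -- A root of a level-n gadget is crossed by every level-(n + 1) segment from F′
  -- to a point right of hi.
  record IsRoot (n : ℕ) (F′ hi : ℚ) (σ : Seg) : Set where
    field
      level : ℕ
      level≤n : level ≤ n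
      ofLevel : OfLevel level σ
      F′≤base : F′ ℚ.≤ base σ
      tip≤hi : tipX σ ℚ.≤ hi
      reaches : slope (suc n) * (tipX σ - F′) ℚ.≤ tipY σ

  IsRoot-lift : ∀ {n F′ hi hi′ σ} → hi ℚ.≤ hi′ → IsRoot n F′ hi σ → IsRoot (suc n) F′ hi′ σ
  IsRoot-lift {n} {F′} {σ = σ} hi≤hi′ r = record
    { level = level ; level≤n = ℕ.m≤n⇒m≤1+n level≤n ; ofLevel = ofLevel ; F′≤base = F′≤base
    ; tip≤hi = ≤-trans tip≤hi hi≤hi′
    ; reaches = ≤-trans (ℚ.*-monoʳ-≤-nonNeg (tipX σ - F′) {{ℚ.nonNegative 0≤tip-F′}} (slope-antimono (ℕ.n≤1+n (suc n))))
                        reaches }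
    where
    open IsRoot r
    0≤tip-F′ : 0ℚ ℚ.≤ tipX σ - F′
    0≤tip-F′ = p≤q⇒0≤q-p (≤-trans F′≤base (<⇒≤ (OfLevel.base<tip ofLevel)))

  OutOfReach : ℕ → ℚ → Seg → Set
  OutOfReach n F σ = Safe F σ ⊎ Pending (suc n) F σ

  OutOfReach-mono : ∀ {n n′ F F′ σ} → n′ ≤ n → F′ ℚ.≤ F → OutOfReach n F σ → OutOfReach n′ F′ σ
  OutOfReach-mono _     F′≤F (inj₁ safe)    = inj₁ (Safe-mono F′≤F safe)
  OutOfReach-mono n′≤n F′≤F (inj₂ pending) = inj₂ (Pending-mono (s≤s n′≤n) F′≤F pending)

  OutOfReach⇒¬Intersect : ∀ {n F σ ℓ b x} (b<x : b ℚ.< x) → OutOfReach n F σ → ℓ ≤ suc n → ℓ < N →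
    b ℚ.≤ F → ¬ Intersect σ (levelSeg ℓ b x b<x)
  OutOfReach⇒¬Intersect b<x (inj₁ safe)    _     ℓ<N b≤F = Safe⇒¬Intersect b<x safe b≤F ℓ<N
  OutOfReach⇒¬Intersect b<x (inj₂ pending) ℓ≤1+n _   b≤F = Pending⇒¬Intersect b<x pending ℓ≤1+n b≤F

  record Ready (n : ℕ) (F : ℚ) (L : List Seg) : Set where
    field
      outOfReach : ∀ i → i < length L → OutOfReach n F (nth L i)
      hitSafe : HitAre (Safe F) L
      hitOnce : HitOnce L

  Ready-[] : ∀ n F → Ready n F []
  Ready-[] n F = record { outOfReach = λ _ () ; hitSafe = λ _ _ _ () ; hitOnce = λ _ _ _ _ _ () }

  -- The outcome of the level-n strategy played after L in the strip [F - width n , F].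
  record Gadget (n : ℕ) (F : ℚ) (L : List Seg) : Set where
    field
      L′ : List Seg
      extends : L ≼ L′
      F′ : ℚ
      F-width≤F′ : F - width n ℚ.≤ F′
      F′<F : F′ ℚ.< F
      inStrip : ∀ i → length L ≤ i → i < length L′ → InStrip (F - width n) F (nth L′ i)
      hitSafe : HitAre (Safe F′) L′
      hitOnce : HitOnce L′
      roots : Fin (suc n) → Entry (IsRoot n F′ F) L′
      roots-rainbow : Rainbow roots

  gadget-zero : 0 < N → ∀ F L → Ready 0 F L → Gadget 0 F L
  gadget-zero 0<N F L ready = record
    { L′ = L ∷ʳ u ; extends = ≼-∷ʳ L u ; F′ = F - 1ℚ ; F-width≤F′ = ≤-refl ; F′<F = F-1<F
    ; inStrip = inStrip ; hitSafe = hitSafe ; hitOnce = hitOnce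
    ; roots = λ _ → Entry-∷ʳ L u-root ; roots-rainbow = λ { Fin.zero Fin.zero _ → refl } }
    where
    F-1<F : F - 1ℚ ℚ.< F
    F-1<F = p-1<p F
    u : Seg
    u = levelSeg 0 (F - 1ℚ) F F-1<F
    u-misses : ∀ i → i < length L → ¬ Intersect (nth L i) u
    u-misses i i<L = OutOfReach⇒¬Intersect F-1<F (Ready.outOfReach ready i i<L) z≤n 0<N (<⇒≤ F-1<F)
    u-root : IsRoot 0 (F - 1ℚ) F u
    u-root = record
      { level = 0 ; level≤n = z≤n ; ofLevel = levelSeg-OfLevel 0 (F - 1ℚ) F F-1<F ; F′≤base = ≤-refl ; tip≤hi = ≤-refl
      ; reaches = ℚ.*-monoʳ-≤-nonNeg (F - (F - 1ℚ)) {{ℚ.nonNegative (p≤q⇒0≤q-p (<⇒≤ F-1<F))}} (slope-antimono {0} {1} z≤n) }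
    inStrip : ∀ i → length L ≤ i → i < length (L ∷ʳ u) → InStrip (F - width 0) F (nth (L ∷ʳ u) i)
    inStrip i L≤i i< rewrite ∷ʳ-new-index L u L≤i i< | nth-∷ʳ-length L u =
      record { level = 0 ; ofLevel = levelSeg-OfLevel 0 (F - 1ℚ) F F-1<F ; lo≤base = ≤-refl ; tip≤hi = ≤-refl }
    hitSafe : HitAre (Safe (F - 1ℚ)) (L ∷ʳ u)
    hitSafe = HitAre-∷ʳ {Safe (F - 1ℚ)} {L} {u}
      (HitAre-mono {Safe F} {L = L} (Safe-mono (<⇒≤ F-1<F)) (Ready.hitSafe ready))
      (λ i i<L meet → ⊥-elim (u-misses i i<L meet))
    hitOnce : HitOnce (L ∷ʳ u)
    hitOnce = HitOnce-∷ʳ {L} {u} (Ready.hitOnce ready)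
      (λ i j i<j j<L meet → Safe⇒¬Intersect F-1<F (Ready.hitSafe ready i j i<j j<L meet) (<⇒≤ F-1<F) 0<N)

  module Step (n : ℕ) (1+n<N : suc n < N) (F : ℚ) (L₀ : List Seg) (ready₀ : Ready (suc n) F L₀)
              (recurse : ∀ F L → Ready n F L → Gadget n F L) where

    margin F₁ lo : ℚ
    margin = fromℕ N * slots n
    F₁ = F - margin
    lo = F - width (suc n)

    abstract
      F₁<F : F₁ ℚ.< F
      F₁<F = <-gap margin (*-pos (fromℕ-pos (ℕ.<-trans (s≤s z≤n) 1+n<N))
                                  (*-pos (fromℕ-pos {suc (suc n)} (s≤s z≤n)) (gap-pos n)))
        (solve 2 (λ F c → F := (F :- c) :+ c) refl F margin)

      room-initially : lo + fromℕ (suc (suc n)) * gap n ℚ.≤ F₁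
      room-initially = ℚ.≤-reflexive
        (solve 3 (λ F N s → (F :- (N :* s :+ s)) :+ s := F :- N :* s) refl F (fromℕ N) (slots n))

      room-shrinks : ∀ {Fc r} → lo + fromℕ (suc r) * gap n ℚ.≤ Fc → lo + fromℕ r * gap n ℚ.≤ Fc - gap n
      room-shrinks {Fc} {r} room = 0≤q-p⇒p≤q (subst (0ℚ ℚ.≤_)
        (solve 4 (λ Fc lo r g → Fc :- (lo :+ (con 1ℚ :+ r) :* g) := (Fc :- g) :- (lo :+ r :* g)) refl Fc lo (fromℕ r) (gap n))
        (p≤q⇒0≤q-p room))

      lo≤slot : ∀ {Fc r} → lo + fromℕ (suc r) * gap n ℚ.≤ Fc → lo ℚ.≤ Fc - width n
      lo≤slot {Fc} {r} room = ≤-gap ((Fc - (lo + (1ℚ + fromℕ r) * gap n)) + fromℕ r * gap n + (gap n - width n))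
        (+-nonNeg (+-nonNeg (p≤q⇒0≤q-p room) (*-nonNeg (fromℕ-nonNeg r) (<⇒≤ (gap-pos n))))
                  (<⇒≤ (p<q⇒0<q-p (width<gap n))))
        (solve 5 (λ Fc lo r g w → Fc :- w := lo :+ (((Fc :- (lo :+ (con 1ℚ :+ r) :* g)) :+ r :* g) :+ (g :- w)))
           refl Fc lo (fromℕ r) (gap n) (width n))

      lo≤Fc : ∀ {Fc} → lo + fromℕ 0 * gap n ℚ.≤ Fc → lo ℚ.≤ Fc
      lo≤Fc {Fc} = subst (ℚ._≤ Fc) (solve 2 (λ lo g → lo :+ con 0ℚ :* g := lo) refl lo (gap n))

      Fc-gap<Fc-width : ∀ Fc → Fc - gap n ℚ.< Fc - width n
      Fc-gap<Fc-width Fc = <-gap (gap n - width n) (p<q⇒0<q-p (width<gap n))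
        (solve 3 (λ Fc g w → Fc :- w := (Fc :- g) :+ (g :- w)) refl Fc (gap n) (width n))

      Fc-gap≤Fc : ∀ Fc → Fc - gap n ℚ.≤ Fc
      Fc-gap≤Fc Fc = ≤-gap (gap n) (<⇒≤ (gap-pos n)) (solve 2 (λ Fc g → Fc := (Fc :- g) :+ g) refl Fc (gap n))

      Fc-gap≡safeBound : ∀ Fc → Fc - gap n ≡ safeBound (Fc - width n) Fc
      Fc-gap≡safeBound Fc = solve 3 (λ Fc N w → Fc :- ((N :+ con 1ℚ) :* w :+ con 1ℚ)
        := (Fc :- w) :- (N :* (Fc :- (Fc :- w)) :+ con 1ℚ)) refl Fc (fromℕ N) (width n)

      cap-reaches : ∀ F′ b → lo ℚ.≤ F′ → F′ ℚ.≤ b → b ℚ.≤ F₁ →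
        slope (suc (suc n)) * (F - F′) ℚ.≤ slope (suc n) * (F - b)
      cap-reaches F′ b lo≤F′ F′≤b b≤F₁ =
        subst (λ q → slope (suc (suc n)) * (F - F′) ℚ.≤ q * (F - b)) (sym (slope-suc 1+n<N))
        (≤-gap ((F₁ - b) + (fromℕ N - slope (suc (suc n))) * (b - F′) + fromℕ N * ((F′ - lo) + (F₁ - b)))
          (+-nonNeg (+-nonNeg (p≤q⇒0≤q-p b≤F₁) (*-nonNeg (p≤q⇒0≤q-p (slope≤N (suc (suc n)))) (p≤q⇒0≤q-p F′≤b)))
                    (*-nonNeg (fromℕ-nonNeg N) (+-nonNeg (p≤q⇒0≤q-p lo≤F′) (p≤q⇒0≤q-p b≤F₁))))
          (solve 6 (λ s F F′ b N r → (con 1ℚ :+ s) :* (F :- b) :=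
              s :* (F :- F′) :+ ((((F :- N :* r) :- b) :+ (N :- s) :* (b :- F′)) :+
                                 N :* ((F′ :- (F :- (N :* r :+ r))) :+ ((F :- N :* r) :- b))))
            refl (slope (suc (suc n))) F F′ b (fromℕ N) (slots n)))

    record IsCap (Fc : ℚ) (σ : Seg) : Set where
      field
        ofLevel : OfLevel (suc n) σ
        tip≡F : tipX σ ≡ F
        Fc<base : Fc ℚ.< base σ
        base≤F₁ : base σ ℚ.≤ F₁

    IsCap-mono : ∀ {Fc Fc′ σ} → Fc′ ℚ.≤ Fc → IsCap Fc σ → IsCap Fc′ σ
    IsCap-mono Fc′≤Fc c = record
      { ofLevel = ofLevel ; tip≡F = tip≡F ; Fc<base = ≤-<-trans Fc′≤Fc Fc<base ; base≤F₁ = base≤F₁ }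
      where open IsCap c

    IsCap⇒IsRoot : ∀ {Fc F′ σ} → lo ℚ.≤ F′ → F′ ℚ.≤ Fc → IsCap Fc σ → IsRoot (suc n) F′ F σ
    IsCap⇒IsRoot {Fc} {F′} {σ} lo≤F′ F′≤Fc c = record
      { level = suc n ; level≤n = ℕ.≤-refl ; ofLevel = ofLevel ; F′≤base = <⇒≤ F′<base
      ; tip≤hi = ℚ.≤-reflexive tip≡F
      ; reaches = subst₂ (λ X Y → slope (suc (suc n)) * (X - F′) ℚ.≤ Y) (sym tip≡F)
          (sym (trans (OfLevel.on-slope ofLevel) (cong (λ X → slope (suc n) * (X - base σ)) tip≡F)))
          (cap-reaches F′ (base σ) lo≤F′ (<⇒≤ F′<base) base≤F₁) }
      where
      open IsCap c
      F′<base = ≤-<-trans F′≤Fc Fc<base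

    -- The state after c rounds, with room left for rem more slots.
    record LoopState (c rem : ℕ) : Set where
      field
        Lc : List Seg
        extends : L₀ ≼ Lc
        Fc : ℚ
        room : lo + fromℕ rem * gap n ℚ.≤ Fc
        Fc≤F₁ : Fc ℚ.≤ F₁
        ready : Ready n Fc Lc
        inStrip : ∀ i → length L₀ ≤ i → i < length Lc → InStrip lo F (nth Lc i)
        caps : Fin c → Entry (IsCap Fc) Lc
        caps-rainbow : Rainbow caps

    module Round (c rem : ℕ) (st : LoopState c (suc rem)) where
      open LoopState st
      module G = Gadget (recurse Fc Lc ready)
      open G using (F′; roots)

      L₁ : List Seg
      L₁ = G.L′
      capPos : Fin c → ℕ
      capPos a = Entry.pos (caps a)
      rootPos : Fin (suc n) → ℕ
      rootPos b = Entry.pos (roots b)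

      Fc≤F : Fc ℚ.≤ F
      Fc≤F = ≤-trans Fc≤F₁ (<⇒≤ F₁<F)
      F′≤Fc : F′ ℚ.≤ Fc
      F′≤Fc = <⇒≤ G.F′<F
      lo≤F′ : lo ℚ.≤ F′
      lo≤F′ = ≤-trans (lo≤slot {r = rem} room) G.F-width≤F′
      F′<F : F′ ℚ.< F
      F′<F = <-≤-trans G.F′<F Fc≤F

      inStrip₁ : ∀ i → length L₀ ≤ i → i < length L₁ → InStrip lo F (nth L₁ i)
      inStrip₁ i L₀≤i i<L₁ with ℕ.<-≤-connex i (length Lc)
      ... | inj₁ i<Lc = subst (InStrip lo F) (sym (≼-nth G.extends i i<Lc)) (inStrip i L₀≤i i<Lc)
      ... | inj₂ Lc≤i = InStrip-mono (lo≤slot {r = rem} room) Fc≤F (G.inStrip i Lc≤i i<L₁)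

      FreshCap : Fin c → Set
      FreshCap a = ∀ b → colour L₁ (rootPos b) ≢ colour L₁ (capPos a)

      freshCap? : Dec (∃ FreshCap)
      freshCap? = Fin.any? (λ a → Fin.all? (λ b → ¬? (colour L₁ (rootPos b) ℕ.≟ colour L₁ (capPos a))))

      stop : ∃ FreshCap → Gadget (suc n) F L₀
      stop (a , fresh) = record
        { L′ = L₁ ; extends = ≼-trans extends G.extends ; F′ = F′ ; F-width≤F′ = lo≤F′ ; F′<F = F′<F
        ; inStrip = inStrip₁ ; hitSafe = G.hitSafe ; hitOnce = G.hitOnce
        ; roots = cap Vector.∷ λ b → Entry-map (IsRoot-lift Fc≤F) (roots b)
        ; roots-rainbow = Rainbow-∷ cap fresh G.roots-rainbow }
        where
        cap = Entry-map (IsCap⇒IsRoot lo≤F′ F′≤Fc) (Entry-≼ G.extends (caps a))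

      capColour∈roots : ¬ ∃ FreshCap → ∀ a → Σ (Fin (suc n)) λ b → colour L₁ (capPos a) ≡ colour L₁ (rootPos b)
      capColour∈roots none a with Fin.any? (λ b → colour L₁ (capPos a) ℕ.≟ colour L₁ (rootPos b))
      ... | yes found = found
      ... | no  absent = ⊥-elim (none (a , λ b same → absent (b , sym same)))

      w : Seg
      w = levelSeg (suc n) F′ F F′<F
      L₂ : List Seg
      L₂ = L₁ ∷ʳ w
      Fc′ : ℚ
      Fc′ = Fc - gap n

      Fc′<F′ : Fc′ ℚ.< F′
      Fc′<F′ = <-≤-trans (Fc-gap<Fc-width Fc) G.F-width≤F′

      w-misses-old : ∀ i → i < length Lc → ¬ Intersect (nth L₁ i) w
      w-misses-old i i<Lc meet = OutOfReach⇒¬Intersect F′<F (Ready.outOfReach ready i i<Lc) ℕ.≤-refl 1+n<N F′≤Fc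
        (subst (λ σ → Intersect σ w) (≼-nth G.extends i i<Lc) meet)

      w-crosses-roots : ∀ b → Intersect (nth L₁ (rootPos b)) w
      w-crosses-roots b = shallower-crosses (nth L₁ (rootPos b)) w (slope level) (slope (suc n))
        (OfLevel.on-slope ofLevel) refl (slope-nonNeg (suc n)) F′≤base (OfLevel.base<tip ofLevel) (≤-trans tip≤hi Fc≤F)
        (slope-strictAntimono (s≤s level≤n) (ℕ.<⇒≤ 1+n<N)) reaches
        where open IsRoot (Entry.holds (roots b))

      new-safe : ∀ i → length Lc ≤ i → i < length L₁ → Safe Fc′ (nth L₁ i)
      new-safe i Lc≤i i<L₁ rewrite Fc-gap≡safeBound Fc = InStrip⇒Safe (G.inStrip i Lc≤i i<L₁)

      outOfReach₂ : ∀ i → i < length L₂ → OutOfReach n Fc′ (nth L₂ i)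
      outOfReach₂ i i<L₂ with ∷ʳ-index L₁ w i i<L₂
      ... | inj₂ refl = inj₂ (subst (Pending (suc n) Fc′) (sym (nth-∷ʳ-length L₁ w)) record
        { level = suc n ; λ₀≤level = ℕ.≤-refl ; level<N = 1+n<N
        ; ofLevel = levelSeg-OfLevel (suc n) F′ F F′<F ; F<base = Fc′<F′ })
      ... | inj₁ i<L₁ with ℕ.<-≤-connex i (length Lc)
      ...   | inj₁ i<Lc = subst (OutOfReach n Fc′) (sym (trans (nth-∷ʳ L₁ w i i<L₁) (≼-nth G.extends i i<Lc)))
                            (OutOfReach-mono ℕ.≤-refl (Fc-gap≤Fc Fc) (Ready.outOfReach ready i i<Lc))
      ...   | inj₂ Lc≤i = subst (OutOfReach n Fc′) (sym (nth-∷ʳ L₁ w i i<L₁)) (inj₁ (new-safe i Lc≤i i<L₁))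

      hitSafe₂ : HitAre (Safe Fc′) L₂
      hitSafe₂ = HitAre-∷ʳ {Safe Fc′} {L₁} {w}
        (HitAre-mono {Safe F′} {L = L₁} (Safe-mono (<⇒≤ Fc′<F′)) G.hitSafe) hitByW
        where
        hitByW : ∀ i → i < length L₁ → Intersect (nth L₁ i) w → Safe Fc′ (nth L₁ i)
        hitByW i i<L₁ meet with ℕ.<-≤-connex i (length Lc)
        ... | inj₁ i<Lc = ⊥-elim (w-misses-old i i<Lc meet)
        ... | inj₂ Lc≤i = new-safe i Lc≤i i<L₁

      hitOnce₂ : HitOnce L₂
      hitOnce₂ = HitOnce-∷ʳ {L₁} {w} G.hitOnce
        (λ i j i<j j<L₁ meet → Safe⇒¬Intersect F′<F (G.hitSafe i j i<j j<L₁ meet) ℚ.≤-refl 1+n<N)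

      inStrip₂ : ∀ i → length L₀ ≤ i → i < length L₂ → InStrip lo F (nth L₂ i)
      inStrip₂ i L₀≤i i<L₂ with ∷ʳ-index L₁ w i i<L₂
      ... | inj₂ refl = subst (InStrip lo F) (sym (nth-∷ʳ-length L₁ w)) record
        { level = suc n ; ofLevel = levelSeg-OfLevel (suc n) F′ F F′<F ; lo≤base = lo≤F′ ; tip≤hi = ℚ.≤-refl }
      ... | inj₁ i<L₁ = subst (InStrip lo F) (sym (nth-∷ʳ L₁ w i i<L₁)) (inStrip₁ i L₀≤i i<L₁)

      Lc≼L₂ : Lc ≼ L₂
      Lc≼L₂ = ≼-trans G.extends (≼-∷ʳ L₁ w)

      -- Every old cap repeats a root colour, and w crosses all roots.
      w-colour-fresh : ¬ ∃ FreshCap → ∀ a → colour L₂ (capPos a) ≢ colour L₂ (length L₁)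
      w-colour-fresh none a same = colour-∷ʳ-≢ proper L₁ w (rootPos b) (Entry.pos< (roots b)) (w-crosses-roots b)
        (trans (sym capb) same)
        where
        b = proj₁ (capColour∈roots none a)
        capb : colour L₂ (capPos a) ≡ colour L₂ (rootPos b)
        capb = trans (≼-colour Lc≼L₂ (capPos a) (Entry.pos< (caps a)))
          (trans (sym (≼-colour G.extends (capPos a) (Entry.pos< (caps a))))
          (trans (proj₂ (capColour∈roots none a))
                 (sym (≼-colour (≼-∷ʳ L₁ w) (rootPos b) (Entry.pos< (roots b))))))

      next : ¬ ∃ FreshCap → LoopState (suc c) rem
      next none = record
        { Lc = L₂ ; extends = ≼-trans extends Lc≼L₂ ; Fc = Fc′ ; room = room-shrinks {r = rem} room
        ; Fc≤F₁ = ≤-trans (Fc-gap≤Fc Fc) Fc≤F₁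
        ; ready = record { outOfReach = outOfReach₂ ; hitSafe = hitSafe₂ ; hitOnce = hitOnce₂ }
        ; inStrip = inStrip₂
        ; caps = newCap Vector.∷ oldCaps
        ; caps-rainbow = Rainbow-∷ newCap (w-colour-fresh none) (Rainbow-≼ Lc≼L₂ {weakened} caps-rainbow) }
        where
        newCap : Entry (IsCap Fc′) L₂
        newCap = Entry-∷ʳ L₁ record
          { ofLevel = levelSeg-OfLevel (suc n) F′ F F′<F ; tip≡F = refl ; Fc<base = Fc′<F′
          ; base≤F₁ = ≤-trans F′≤Fc Fc≤F₁ }
        weakened : Fin c → Entry (IsCap Fc′) Lc
        weakened a = Entry-map (IsCap-mono (Fc-gap≤Fc Fc)) (caps a)
        oldCaps : Fin c → Entry (IsCap Fc′) L₂
        oldCaps a = Entry-≼ Lc≼L₂ (weakened a)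

    finish : ∀ {c} → c ≡ suc (suc n) → LoopState c zero → Gadget (suc n) F L₀
    finish refl st = record
      { L′ = Lc ; extends = extends ; F′ = Fc ; F-width≤F′ = lo≤Fc room ; F′<F = ≤-<-trans Fc≤F₁ F₁<F
      ; inStrip = inStrip ; hitSafe = Ready.hitSafe ready ; hitOnce = Ready.hitOnce ready
      ; roots = λ a → Entry-map (IsCap⇒IsRoot (lo≤Fc room) ℚ.≤-refl) (caps a) ; roots-rainbow = caps-rainbow }
      where open LoopState st

    loop : ∀ c rem → c ℕ.+ rem ≡ suc (suc n) → LoopState c rem → Gadget (suc n) F L₀
    loop c zero      c+0≡ st = finish (trans (sym (ℕ.+-identityʳ c)) c+0≡) st
    loop c (suc rem) c+r≡ st with Round.freshCap? c rem st
    ... | yes found = Round.stop c rem st found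
    ... | no  none  = loop (suc c) rem (trans (sym (ℕ.+-suc c rem)) c+r≡) (Round.next c rem st none)

    initial : LoopState 0 (suc (suc n))
    initial = record
      { Lc = L₀ ; extends = ≼-refl L₀ ; Fc = F₁ ; room = room-initially ; Fc≤F₁ = ℚ.≤-refl
      ; ready = record
        { outOfReach = λ i i<L₀ → OutOfReach-mono (ℕ.n≤1+n n) (<⇒≤ F₁<F) (Ready.outOfReach ready₀ i i<L₀)
        ; hitSafe = HitAre-mono {Safe F} {L = L₀} (Safe-mono (<⇒≤ F₁<F)) (Ready.hitSafe ready₀)
        ; hitOnce = Ready.hitOnce ready₀ }
      ; inStrip = λ i L₀≤i i<L₀ → ⊥-elim (ℕ.<⇒≱ i<L₀ L₀≤i)
      ; caps = λ () ; caps-rainbow = λ () }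

    run : Gadget (suc n) F L₀
    run = loop 0 (suc (suc n)) refl initial

  gadget : ∀ n → n < N → ∀ F L → Ready n F L → Gadget n F L
  gadget zero    0<N   = gadget-zero 0<N
  gadget (suc n) 1+n<N F L ready = Step.run n 1+n<N F L ready (gadget n (ℕ.<-trans (ℕ.n<1+n n) 1+n<N))

proposition3 : (A : OnlineAlg) → IsOnlineColoring A → (k : ℕ) → k ≥ 1 →
    ∃[ ss ] (TriangleFree ss × UsesAtLeast A ss k)
proposition3 A proper zero    ()
proposition3 A proper (suc n) _ =
  L′ , HitOnce⇒TriangleFree L′ hitOnce , Rainbow⇒UsesAtLeast roots roots-rainbow
  where
  open Presentations A
  open Construction A proper (suc n)
  open Gadget (gadget n (n<1+n n) 0ℚ [] (Ready-[] n 0ℚ))
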